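{- Let $\phi,\psi$ be two tree-compatible linear endomorphisms of $D_E\otimes D_V$ such that $\phi_{13}\circ\psi_{23}=\psi_{23}\circ\phi_{13}$. Then $\phi\circ\psi$ is tree-compatible, and for every $(\alpha,\beta)\in\mathbb{K}^2$, $\alpha\phi+\beta\psi$ is tree-compatible.
   Context: $\mathbb{K}$ is a field of characteristic zero; $D_E,D_V$ are vector spaces. For a linear $\phi:D_E\otimes D_V\to D_E\otimes D_V$, with $\tau$ the flip of $D_E\otimes D_E$, define on $D_E\otimes D_E\otimes D_V$: $\phi_{23}=\mathrm{Id}_{D_E}\otimes\phi$ and $\phi_{13}=(\tau\otimes\mathrm{Id}_{D_V})\circ(\mathrm{Id}_{D_E}\otimes\phi)\circ(\tau\otimes\mathrm{Id}_{D_V})$. $\phi$ is tree-compatible if $\phi_{13}\circ\phi_{23}=\phi_{23}\circ\phi_{13}$. -}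

module Defs where

open import Level using (Level; _⊔_) renaming (suc to lsuc)
open import Data.Nat using (ℕ; zero; suc)
open import Data.Product using (Σ; _×_; _,_)
open import Relation.Nullary using (¬_)
open import Algebra.Bundles using (CommutativeRing)
open import Algebra.Module.Bundles using (Module)

module _ {c ℓ : Level} (K : CommutativeRing c ℓ) where
  open CommutativeRing K

  IsField : Set (c ⊔ ℓ)
  IsField = (¬ (1# ≈ 0#)) × (∀ x → ¬ (x ≈ 0#) → Σ Carrier λ y → x * y ≈ 1#)

  natK : ℕ → Carrier
  natK zero    = 0#
  natK (suc n) = 1# + natK n

  CharacteristicZero : Set ℓ
  CharacteristicZero = ∀ n → ¬ (natK (suc n) ≈ 0#)

-- Algebraic tensor products of K-vector spaces, built as the free
-- K-vector space on pairs modulo the bilinearity relations (a setoid).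

module Tensor {c ℓ : Level} (K : CommutativeRing c ℓ) where
  open CommutativeRing K renaming (Carrier to 𝕂)

  record Space (a ℓa : Level) : Set (c ⊔ lsuc (a ⊔ ℓa)) where
    field
      Vec  : Set a
      _≋_  : Vec → Vec → Set ℓa
      _⊕_  : Vec → Vec → Vec
      _⊙_  : 𝕂 → Vec → Vec
      o    : Vec

  fromModule : ∀ {m ℓm} → Module K m ℓm → Space m ℓm
  fromModule M = record
    { Vec = Carrierᴹ ; _≋_ = _≈ᴹ_ ; _⊕_ = _+ᴹ_ ; _⊙_ = _*ₗ_ ; o = 0ᴹ }
    where open Module M

  module _ {a ℓa b ℓb : Level} (A : Space a ℓa) (B : Space b ℓb) where
    private
      module A = Space A
      module B = Space B

    data Tm : Set (c ⊔ a ⊔ b) where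
      𝟎   : Tm
      _⊗_ : A.Vec → B.Vec → Tm
      _⊞_ : Tm → Tm → Tm
      _⊡_ : 𝕂 → Tm → Tm

    infix 4 _≈T_
    data _≈T_ : Tm → Tm → Set (c ⊔ ℓ ⊔ a ⊔ ℓa ⊔ b ⊔ ℓb) where
      ≈refl  : ∀ {s} → s ≈T s
      ≈sym   : ∀ {s t} → s ≈T t → t ≈T s
      ≈trans : ∀ {s t u} → s ≈T t → t ≈T u → s ≈T u
      ⊞-cong : ∀ {s s' t t'} → s ≈T s' → t ≈T t' → (s ⊞ t) ≈T (s' ⊞ t')
      ⊡-cong : ∀ {x y s t} → x ≈ y → s ≈T t → (x ⊡ s) ≈T (y ⊡ t)
      ⊗-cong : ∀ {u u' v v'} → u A.≋ u' → v B.≋ v' → (u ⊗ v) ≈T (u' ⊗ v')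
      ⊞-assoc : ∀ s t u → ((s ⊞ t) ⊞ u) ≈T (s ⊞ (t ⊞ u))
      ⊞-comm  : ∀ s t → (s ⊞ t) ≈T (t ⊞ s)
      ⊞-idˡ   : ∀ s → (𝟎 ⊞ s) ≈T s
      ⊞-inv   : ∀ s → (s ⊞ ((- 1#) ⊡ s)) ≈T 𝟎
      ⊡-one   : ∀ s → (1# ⊡ s) ≈T s
      ⊡-assoc : ∀ x y s → ((x * y) ⊡ s) ≈T (x ⊡ (y ⊡ s))
      ⊡-distʳ : ∀ x y s → ((x + y) ⊡ s) ≈T ((x ⊡ s) ⊞ (y ⊡ s))
      ⊡-distˡ : ∀ x s t → (x ⊡ (s ⊞ t)) ≈T ((x ⊡ s) ⊞ (x ⊡ t))
      ⊗-addˡ : ∀ u u' v → ((u A.⊕ u') ⊗ v) ≈T ((u ⊗ v) ⊞ (u' ⊗ v))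
      ⊗-addʳ : ∀ u v v' → (u ⊗ (v B.⊕ v')) ≈T ((u ⊗ v) ⊞ (u ⊗ v'))
      ⊗-smulˡ : ∀ x u v → ((x A.⊙ u) ⊗ v) ≈T (x ⊡ (u ⊗ v))
      ⊗-smulʳ : ∀ x u v → (u ⊗ (x B.⊙ v)) ≈T (x ⊡ (u ⊗ v))

  infixr 6 _⊗S_
  _⊗S_ : ∀ {a ℓa b ℓb} → Space a ℓa → Space b ℓb
       → Space (c ⊔ a ⊔ b) (c ⊔ ℓ ⊔ a ⊔ ℓa ⊔ b ⊔ ℓb)
  A ⊗S B = record
    { Vec = Tm A B ; _≋_ = _≈T_ A B ; _⊕_ = _⊞_ ; _⊙_ = _⊡_ ; o = 𝟎 }

  module _ {a ℓa : Level} (W : Space a ℓa) where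
    open Space W

    IsLinear : (Vec → Vec) → Set (c ⊔ a ⊔ ℓa)
    IsLinear f = (∀ {s t} → s ≋ t → f s ≋ f t)
               × (∀ s t → f (s ⊕ t) ≋ (f s ⊕ f t))
               × (∀ x s → f (x ⊙ s) ≋ (x ⊙ f s))

    _≐_ : (Vec → Vec) → (Vec → Vec) → Set (a ⊔ ℓa)
    f ≐ g = ∀ s → f s ≋ g s

  -- φ₂₃ and φ₁₃ on D_E ⊗ D_E ⊗ D_V, realised as D_E ⊗ (D_E ⊗ D_V)
  module Legs {e ℓe v ℓv : Level} (E : Space e ℓe) (V : Space v ℓv) where
    EV  = E ⊗S V
    EEV = E ⊗S EV
    private
      module EV  = Space EV
      module EEV = Space EEV

    idTensor : (EV.Vec → EV.Vec) → EEV.Vec → EEV.Vec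
    idTensor φ 𝟎       = 𝟎
    idTensor φ (x ⊗ w) = x ⊗ φ w
    idTensor φ (s ⊞ t) = idTensor φ s ⊞ idTensor φ t
    idTensor φ (k ⊡ s) = k ⊡ idTensor φ s

    -- τ ⊗ Id_{D_V} : x ⊗ (y ⊗ v) ↦ y ⊗ (x ⊗ v), extended linearly
    flipInner : Space.Vec E → EV.Vec → EEV.Vec
    flipInner x 𝟎       = 𝟎
    flipInner x (y ⊗ w) = y ⊗ (x ⊗ w)
    flipInner x (s ⊞ t) = flipInner x s ⊞ flipInner x t
    flipInner x (k ⊡ s) = k ⊡ flipInner x s

    τ⊗Id : EEV.Vec → EEV.Vec
    τ⊗Id 𝟎       = 𝟎
    τ⊗Id (x ⊗ w) = flipInner x w
    τ⊗Id (s ⊞ t) = τ⊗Id s ⊞ τ⊗Id t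
    τ⊗Id (k ⊡ s) = k ⊡ τ⊗Id s

    φ₂₃ : (EV.Vec → EV.Vec) → EEV.Vec → EEV.Vec
    φ₂₃ φ = idTensor φ

    φ₁₃ : (EV.Vec → EV.Vec) → EEV.Vec → EEV.Vec
    φ₁₃ φ s = τ⊗Id (idTensor φ (τ⊗Id s))

    TreeCompatible : (EV.Vec → EV.Vec) → Set _
    TreeCompatible φ = _≐_ EEV (λ s → φ₁₃ φ (φ₂₃ φ s)) (λ s → φ₂₃ φ (φ₁₃ φ s))

-- The two legs φ₁₃ and φ₂₃ are conjugate under the flip τ ⊗ Id, which is a
-- linear involution; hence φ ↦ φ₁₃ and φ ↦ φ₂₃ are multiplicative and linear,
-- and conjugating the hypothesis φ₁₃ ψ₂₃ = ψ₂₃ φ₁₃ by τ ⊗ Id gives ψ₁₃ φ₂₃ = φ₂₃ ψ₁₃.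
-- Then each of φ₁₃, ψ₁₃ commutes with each of φ₂₃, ψ₂₃, and commuting operators
-- are stable under composition and linear combination.
module Submission where

open import Defs
open import Level using (Level)
open import Function using (_∘_)
open import Data.Product using (_×_; _,_; proj₁)
open import Algebra.Bundles using (CommutativeRing; AbelianGroup)
open import Algebra.Module.Bundles using (Module)
open import Relation.Binary.Bundles using (Setoid)
import Algebra.Definitions as AlgebraDefinitions
import Algebra.Consequences.Setoid as SetoidConsequences
import Algebra.Properties.AbelianGroup as AbelianGroupProperties
import Algebra.Properties.CommutativeSemigroup as CommutativeSemigroupProperties
import Relation.Binary.Reasoning.Setoid as SetoidReasoning

module TensorSpace {c ℓ : Level} (K : CommutativeRing c ℓ)
                   {a ℓa b ℓb : Level} (A : Tensor.Space K a ℓa) (B : Tensor.Space K b ℓb) where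
  open CommutativeRing K
    using (0#; 1#; _+_; _*_; -_; *-comm; +-identityˡ; zeroʳ)
    renaming (Carrier to 𝕂; refl to 𝕂-refl)
  open Tensor K

  _≈_ : Tm A B → Tm A B → Set _
  _≈_ = _≈T_ A B

  ≈-setoid : Setoid _ _
  ≈-setoid = record
    { Carrier       = Tm A B
    ; _≈_           = _≈_
    ; isEquivalence = record { refl = ≈refl ; sym = ≈sym ; trans = ≈trans } }

  open SetoidConsequences ≈-setoid using (comm∧idˡ⇒id; comm∧invʳ⇒inv)
  open SetoidReasoning ≈-setoid

  ⊞-abelianGroup : AbelianGroup _ _
  ⊞-abelianGroup = record
    { Carrier = Tm A B
    ; _≈_ = _≈_
    ; _∙_ = _⊞_
    ; ε   = 𝟎
    ; _⁻¹ = (- 1#) ⊡_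
    ; isAbelianGroup = record
      { isGroup = record
        { isMonoid = record
          { isSemigroup = record
            { isMagma = record
              { isEquivalence = Setoid.isEquivalence ≈-setoid
              ; ∙-cong        = ⊞-cong
              }
            ; assoc = ⊞-assoc
            }
          ; identity = comm∧idˡ⇒id ⊞-comm ⊞-idˡ
          }
        ; inverse = comm∧invʳ⇒inv ⊞-comm ⊞-inv
        ; ⁻¹-cong = ⊡-cong 𝕂-refl
        }
      ; comm = ⊞-comm
      }
    }

  open AbelianGroupProperties ⊞-abelianGroup using (identityˡ-unique)
  open CommutativeSemigroupProperties (AbelianGroup.commutativeSemigroup ⊞-abelianGroup)
    using () renaming (interchange to ⊞-interchange) public

  ⊡-zeroˡ : ∀ s → (0# ⊡ s) ≈ 𝟎
  ⊡-zeroˡ s = identityˡ-unique (0# ⊡ s) (0# ⊡ s) (begin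
    (0# ⊡ s) ⊞ (0# ⊡ s) ≈⟨ ⊡-distʳ 0# 0# s ⟨
    (0# + 0#) ⊡ s       ≈⟨ ⊡-cong (+-identityˡ 0#) ≈refl ⟩
    0# ⊡ s              ∎)

  ⊡-zeroʳ : ∀ k → (k ⊡ 𝟎) ≈ 𝟎
  ⊡-zeroʳ k = begin
    k ⊡ 𝟎         ≈⟨ ⊡-cong 𝕂-refl (⊡-zeroˡ 𝟎) ⟨
    k ⊡ (0# ⊡ 𝟎)  ≈⟨ ⊡-assoc k 0# 𝟎 ⟨
    (k * 0#) ⊡ 𝟎  ≈⟨ ⊡-cong (zeroʳ k) ≈refl ⟩
    0# ⊡ 𝟎        ≈⟨ ⊡-zeroˡ 𝟎 ⟩
    𝟎             ∎

  ⊡-comm : ∀ k j s → (k ⊡ (j ⊡ s)) ≈ (j ⊡ (k ⊡ s))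
  ⊡-comm k j s = begin
    k ⊡ (j ⊡ s)  ≈⟨ ⊡-assoc k j s ⟨
    (k * j) ⊡ s  ≈⟨ ⊡-cong (*-comm k j) ≈refl ⟩
    (j * k) ⊡ s  ≈⟨ ⊡-assoc j k s ⟩
    j ⊡ (k ⊡ s)  ∎

  Operator : Set _
  Operator = Tm A B → Tm A B

  private
    variable
      f g h f′ g′ f₁ f₂ g₁ g₂ : Operator

  open AlgebraDefinitions _≈_ using (Congruent₁)

  Commute : Operator → Operator → Set _
  Commute f g = _≐_ (A ⊗S B) (f ∘ g) (g ∘ f)

  linearCombination : 𝕂 → Operator → 𝕂 → Operator → Operator
  linearCombination α f β g s = (α ⊡ f s) ⊞ (β ⊡ g s)

  ∘-linear : IsLinear (A ⊗S B) f → IsLinear (A ⊗S B) g → IsLinear (A ⊗S B) (f ∘ g)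
  ∘-linear {f} {g} (f-cong , f-+ , f-⊡) (g-cong , g-+ , g-⊡) =
      (λ p → f-cong (g-cong p))
    , (λ s t → ≈trans (f-cong (g-+ s t)) (f-+ (g s) (g t)))
    , (λ k s → ≈trans (f-cong (g-⊡ k s)) (f-⊡ k (g s)))

  linearCombination-linear : ∀ α β → IsLinear (A ⊗S B) f → IsLinear (A ⊗S B) g
                           → IsLinear (A ⊗S B) (linearCombination α f β g)
  linearCombination-linear {f} {g} α β (f-cong , f-+ , f-⊡) (g-cong , g-+ , g-⊡) =
    (λ p → ⊞-cong (⊡-cong 𝕂-refl (f-cong p)) (⊡-cong 𝕂-refl (g-cong p))) , additive , homogeneous
    where
    additive : ∀ s t → linearCombination α f β g (s ⊞ t)
                       ≈ (linearCombination α f β g s ⊞ linearCombination α f β g t)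
    additive s t = begin
      (α ⊡ f (s ⊞ t)) ⊞ (β ⊡ g (s ⊞ t))
        ≈⟨ ⊞-cong (⊡-cong 𝕂-refl (f-+ s t)) (⊡-cong 𝕂-refl (g-+ s t)) ⟩
      (α ⊡ (f s ⊞ f t)) ⊞ (β ⊡ (g s ⊞ g t))
        ≈⟨ ⊞-cong (⊡-distˡ α (f s) (f t)) (⊡-distˡ β (g s) (g t)) ⟩
      ((α ⊡ f s) ⊞ (α ⊡ f t)) ⊞ ((β ⊡ g s) ⊞ (β ⊡ g t))
        ≈⟨ ⊞-interchange _ _ _ _ ⟩
      ((α ⊡ f s) ⊞ (β ⊡ g s)) ⊞ ((α ⊡ f t) ⊞ (β ⊡ g t))
        ∎
    homogeneous : ∀ k s → linearCombination α f β g (k ⊡ s) ≈ (k ⊡ linearCombination α f β g s)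
    homogeneous k s = begin
      (α ⊡ f (k ⊡ s)) ⊞ (β ⊡ g (k ⊡ s))
        ≈⟨ ⊞-cong (⊡-cong 𝕂-refl (f-⊡ k s)) (⊡-cong 𝕂-refl (g-⊡ k s)) ⟩
      (α ⊡ (k ⊡ f s)) ⊞ (β ⊡ (k ⊡ g s))
        ≈⟨ ⊞-cong (⊡-comm α k (f s)) (⊡-comm β k (g s)) ⟩
      (k ⊡ (α ⊡ f s)) ⊞ (k ⊡ (β ⊡ g s))
        ≈⟨ ⊡-distˡ k _ _ ⟨
      k ⊡ ((α ⊡ f s) ⊞ (β ⊡ g s))
        ∎

  commute-sym : Commute f g → Commute g f
  commute-sym fg s = ≈sym (fg s)

  commute-∘ˡ : Congruent₁ f → Commute f h → Commute g h → Commute (f ∘ g) h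
  commute-∘ˡ {f} {h} {g} f-cong fh gh s = begin
    f (g (h s))  ≈⟨ f-cong (gh s) ⟩
    f (h (g s))  ≈⟨ fh (g s) ⟩
    h (f (g s))  ∎

  commute-∘ʳ : Congruent₁ g → Commute f g → Commute f h → Commute f (g ∘ h)
  commute-∘ʳ {g} {f} {h} g-cong fg fh =
    commute-sym {g ∘ h} (commute-∘ˡ {g} {f} {h} g-cong (commute-sym {f} fg) (commute-sym {f} fh))

  commute-∘ : Congruent₁ f₁ → Congruent₁ g₁
            → Commute f₁ g₁ → Commute f₁ g₂ → Commute f₂ g₁ → Commute f₂ g₂
            → Commute (f₁ ∘ f₂) (g₁ ∘ g₂)
  commute-∘ f₁-cong g₁-cong f₁g₁ f₁g₂ f₂g₁ f₂g₂ =
    commute-∘ˡ f₁-cong (commute-∘ʳ g₁-cong f₁g₁ f₁g₂) (commute-∘ʳ g₁-cong f₂g₁ f₂g₂)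

  commute-linearCombinationˡ : ∀ α β → IsLinear (A ⊗S B) h → Commute f h → Commute g h
                             → Commute (linearCombination α f β g) h
  commute-linearCombinationˡ {h} {f} {g} α β (h-cong , h-+ , h-⊡) fh gh s = begin
    (α ⊡ f (h s)) ⊞ (β ⊡ g (h s))  ≈⟨ ⊞-cong (⊡-cong 𝕂-refl (fh s)) (⊡-cong 𝕂-refl (gh s)) ⟩
    (α ⊡ h (f s)) ⊞ (β ⊡ h (g s))  ≈⟨ ⊞-cong (h-⊡ α (f s)) (h-⊡ β (g s)) ⟨
    h (α ⊡ f s) ⊞ h (β ⊡ g s)      ≈⟨ h-+ _ _ ⟨
    h ((α ⊡ f s) ⊞ (β ⊡ g s))      ∎

  commute-linearCombinationʳ : ∀ α β → IsLinear (A ⊗S B) f → Commute f g → Commute f h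
                             → Commute f (linearCombination α g β h)
  commute-linearCombinationʳ {f} {g} {h} α β f-linear fg fh =
    commute-sym {linearCombination α g β h}
      (commute-linearCombinationˡ {f} {g} {h} α β f-linear (commute-sym {f} fg) (commute-sym {f} fh))

  commute-resp-≐ : Congruent₁ f′ → Congruent₁ g′
                 → _≐_ (A ⊗S B) f f′ → _≐_ (A ⊗S B) g g′ → Commute f′ g′ → Commute f g
  commute-resp-≐ {f′} {g′} {f} {g} f′-cong g′-cong f≐f′ g≐g′ f′g′ s = begin
    f (g s)    ≈⟨ f≐f′ (g s) ⟩
    f′ (g s)   ≈⟨ f′-cong (g≐g′ s) ⟩
    f′ (g′ s)  ≈⟨ f′g′ s ⟩
    g′ (f′ s)  ≈⟨ g′-cong (f≐f′ s) ⟨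
    g′ (f s)   ≈⟨ g≐g′ (f s) ⟨
    g (f s)    ∎

module TreeLegs {c ℓ : Level} (K : CommutativeRing c ℓ)
                {e ℓe v ℓv : Level} (DE : Module K e ℓe) (DV : Module K v ℓv) where
  open CommutativeRing K using (0#) renaming (refl to 𝕂-refl)
  open Tensor K
  open Legs (fromModule DE) (fromModule DV)
  private
    module DE = Module DE
    module E⊗V = TensorSpace K (fromModule DE) (fromModule DV)
  open TensorSpace K (fromModule DE) EV
  open SetoidReasoning ≈-setoid

  idTensor-linear : ∀ {φ} → IsLinear EV φ → IsLinear EEV (idTensor φ)
  idTensor-linear {φ} (φ-cong , φ-+ , φ-⊡) = cong , (λ _ _ → ≈refl) , (λ _ _ → ≈refl)
    where
    cong : ∀ {s t} → s ≈ t → idTensor φ s ≈ idTensor φ t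
    cong ≈refl                 = ≈refl
    cong (≈sym p)              = ≈sym (cong p)
    cong (≈trans p q)          = ≈trans (cong p) (cong q)
    cong (⊞-cong p q)          = ⊞-cong (cong p) (cong q)
    cong (⊡-cong k≈j p)        = ⊡-cong k≈j (cong p)
    cong (⊗-cong p q)          = ⊗-cong p (φ-cong q)
    cong (⊞-assoc _ _ _)       = ⊞-assoc _ _ _
    cong (⊞-comm _ _)          = ⊞-comm _ _
    cong (⊞-idˡ _)             = ⊞-idˡ _
    cong (⊞-inv _)             = ⊞-inv _
    cong (⊡-one _)             = ⊡-one _
    cong (⊡-assoc _ _ _)       = ⊡-assoc _ _ _
    cong (⊡-distʳ _ _ _)       = ⊡-distʳ _ _ _
    cong (⊡-distˡ _ _ _)       = ⊡-distˡ _ _ _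
    cong (⊗-addˡ _ _ _)        = ⊗-addˡ _ _ _
    cong (⊗-addʳ x w w′)       = ≈trans (⊗-cong DE.≈ᴹ-refl (φ-+ w w′)) (⊗-addʳ _ _ _)
    cong (⊗-smulˡ _ _ _)       = ⊗-smulˡ _ _ _
    cong (⊗-smulʳ k x w)       = ≈trans (⊗-cong DE.≈ᴹ-refl (φ-⊡ k w)) (⊗-smulʳ _ _ _)

  flipInner-cong : ∀ x {w w′} → w E⊗V.≈ w′ → flipInner x w ≈ flipInner x w′
  flipInner-cong x ≈refl             = ≈refl
  flipInner-cong x (≈sym p)          = ≈sym (flipInner-cong x p)
  flipInner-cong x (≈trans p q)      = ≈trans (flipInner-cong x p) (flipInner-cong x q)
  flipInner-cong x (⊞-cong p q)      = ⊞-cong (flipInner-cong x p) (flipInner-cong x q)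
  flipInner-cong x (⊡-cong k≈j p)    = ⊡-cong k≈j (flipInner-cong x p)
  flipInner-cong x (⊗-cong p q)      = ⊗-cong p (⊗-cong DE.≈ᴹ-refl q)
  flipInner-cong x (⊞-assoc _ _ _)   = ⊞-assoc _ _ _
  flipInner-cong x (⊞-comm _ _)      = ⊞-comm _ _
  flipInner-cong x (⊞-idˡ _)         = ⊞-idˡ _
  flipInner-cong x (⊞-inv _)         = ⊞-inv _
  flipInner-cong x (⊡-one _)         = ⊡-one _
  flipInner-cong x (⊡-assoc _ _ _)   = ⊡-assoc _ _ _
  flipInner-cong x (⊡-distʳ _ _ _)   = ⊡-distʳ _ _ _
  flipInner-cong x (⊡-distˡ _ _ _)   = ⊡-distˡ _ _ _
  flipInner-cong x (⊗-addˡ _ _ _)    = ⊗-addˡ _ _ _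
  flipInner-cong x (⊗-addʳ _ _ _)    = ≈trans (⊗-cong DE.≈ᴹ-refl (⊗-addʳ _ _ _)) (⊗-addʳ _ _ _)
  flipInner-cong x (⊗-smulˡ _ _ _)   = ⊗-smulˡ _ _ _
  flipInner-cong x (⊗-smulʳ _ _ _)   = ≈trans (⊗-cong DE.≈ᴹ-refl (⊗-smulʳ _ _ _)) (⊗-smulʳ _ _ _)

  flipInner-congˡ : ∀ {x x′} → x DE.≈ᴹ x′ → ∀ w → flipInner x w ≈ flipInner x′ w
  flipInner-congˡ p 𝟎       = ≈refl
  flipInner-congˡ p (y ⊗ w) = ⊗-cong DE.≈ᴹ-refl (⊗-cong p (Module.≈ᴹ-refl DV))
  flipInner-congˡ p (s ⊞ t) = ⊞-cong (flipInner-congˡ p s) (flipInner-congˡ p t)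
  flipInner-congˡ p (k ⊡ s) = ⊡-cong 𝕂-refl (flipInner-congˡ p s)

  flipInner-+ᴹ : ∀ x x′ w → flipInner (x DE.+ᴹ x′) w ≈ (flipInner x w ⊞ flipInner x′ w)
  flipInner-+ᴹ x x′ 𝟎       = ≈sym (⊞-idˡ 𝟎)
  flipInner-+ᴹ x x′ (y ⊗ w) = ≈trans (⊗-cong DE.≈ᴹ-refl (⊗-addˡ _ _ _)) (⊗-addʳ _ _ _)
  flipInner-+ᴹ x x′ (s ⊞ t) =
    ≈trans (⊞-cong (flipInner-+ᴹ x x′ s) (flipInner-+ᴹ x x′ t)) (⊞-interchange _ _ _ _)
  flipInner-+ᴹ x x′ (k ⊡ s) = ≈trans (⊡-cong 𝕂-refl (flipInner-+ᴹ x x′ s)) (⊡-distˡ _ _ _)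

  flipInner-*ₗ : ∀ k x w → flipInner (k DE.*ₗ x) w ≈ (k ⊡ flipInner x w)
  flipInner-*ₗ k x 𝟎       = ≈sym (⊡-zeroʳ k)
  flipInner-*ₗ k x (y ⊗ w) = ≈trans (⊗-cong DE.≈ᴹ-refl (⊗-smulˡ _ _ _)) (⊗-smulʳ _ _ _)
  flipInner-*ₗ k x (s ⊞ t) =
    ≈trans (⊞-cong (flipInner-*ₗ k x s) (flipInner-*ₗ k x t)) (≈sym (⊡-distˡ _ _ _))
  flipInner-*ₗ k x (j ⊡ s) = ≈trans (⊡-cong 𝕂-refl (flipInner-*ₗ k x s)) (⊡-comm j k _)

  τ⊗Id-linear : IsLinear EEV τ⊗Id
  τ⊗Id-linear = cong , (λ _ _ → ≈refl) , (λ _ _ → ≈refl)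
    where
    cong : ∀ {s t} → s ≈ t → τ⊗Id s ≈ τ⊗Id t
    cong ≈refl                              = ≈refl
    cong (≈sym p)                           = ≈sym (cong p)
    cong (≈trans p q)                       = ≈trans (cong p) (cong q)
    cong (⊞-cong p q)                       = ⊞-cong (cong p) (cong q)
    cong (⊡-cong k≈j p)                     = ⊡-cong k≈j (cong p)
    cong (⊗-cong {u' = x′} {v = w} p q)     = ≈trans (flipInner-congˡ p w) (flipInner-cong x′ q)
    cong (⊞-assoc _ _ _)                    = ⊞-assoc _ _ _
    cong (⊞-comm _ _)                       = ⊞-comm _ _
    cong (⊞-idˡ _)                          = ⊞-idˡ _
    cong (⊞-inv _)                          = ⊞-inv _
    cong (⊡-one _)                          = ⊡-one _
    cong (⊡-assoc _ _ _)                    = ⊡-assoc _ _ _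
    cong (⊡-distʳ _ _ _)                    = ⊡-distʳ _ _ _
    cong (⊡-distˡ _ _ _)                    = ⊡-distˡ _ _ _
    cong (⊗-addˡ x x′ w)                    = flipInner-+ᴹ x x′ w
    cong (⊗-addʳ _ _ _)                     = ≈refl
    cong (⊗-smulˡ k x w)                    = flipInner-*ₗ k x w
    cong (⊗-smulʳ _ _ _)                    = ≈refl

  τ⊗Id-cong : ∀ {s t} → s ≈ t → τ⊗Id s ≈ τ⊗Id t
  τ⊗Id-cong = proj₁ τ⊗Id-linear

  τ⊗Id-flipInner : ∀ x w → τ⊗Id (flipInner x w) ≈ (x ⊗ w)
  τ⊗Id-flipInner x 𝟎       = begin
    𝟎              ≈⟨ ⊡-zeroˡ (x ⊗ 𝟎) ⟨
    0# ⊡ (x ⊗ 𝟎)   ≈⟨ ⊗-smulʳ 0# x 𝟎 ⟨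
    x ⊗ (0# ⊡ 𝟎)   ≈⟨ ⊗-cong DE.≈ᴹ-refl (E⊗V.⊡-zeroˡ 𝟎) ⟩
    x ⊗ 𝟎          ∎
  τ⊗Id-flipInner x (y ⊗ w) = ≈refl
  τ⊗Id-flipInner x (s ⊞ t) =
    ≈trans (⊞-cong (τ⊗Id-flipInner x s) (τ⊗Id-flipInner x t)) (≈sym (⊗-addʳ _ _ _))
  τ⊗Id-flipInner x (k ⊡ s) =
    ≈trans (⊡-cong 𝕂-refl (τ⊗Id-flipInner x s)) (≈sym (⊗-smulʳ _ _ _))

  τ⊗Id-involutive : ∀ s → τ⊗Id (τ⊗Id s) ≈ s
  τ⊗Id-involutive 𝟎       = ≈refl
  τ⊗Id-involutive (x ⊗ w) = τ⊗Id-flipInner x w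
  τ⊗Id-involutive (s ⊞ t) = ⊞-cong (τ⊗Id-involutive s) (τ⊗Id-involutive t)
  τ⊗Id-involutive (k ⊡ s) = ⊡-cong 𝕂-refl (τ⊗Id-involutive s)

  φ₁₃-linear : ∀ {φ} → IsLinear EV φ → IsLinear EEV (φ₁₃ φ)
  φ₁₃-linear φ-linear = ∘-linear τ⊗Id-linear (∘-linear (idTensor-linear φ-linear) τ⊗Id-linear)

  φ₂₃-∘ : ∀ φ ψ → _≐_ EEV (φ₂₃ (φ ∘ ψ)) (φ₂₃ φ ∘ φ₂₃ ψ)
  φ₂₃-∘ φ ψ 𝟎       = ≈refl
  φ₂₃-∘ φ ψ (x ⊗ w) = ≈refl
  φ₂₃-∘ φ ψ (s ⊞ t) = ⊞-cong (φ₂₃-∘ φ ψ s) (φ₂₃-∘ φ ψ t)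
  φ₂₃-∘ φ ψ (k ⊡ s) = ⊡-cong 𝕂-refl (φ₂₃-∘ φ ψ s)

  φ₁₃-∘ : ∀ {φ} ψ → IsLinear EV φ → _≐_ EEV (φ₁₃ (φ ∘ ψ)) (φ₁₃ φ ∘ φ₁₃ ψ)
  φ₁₃-∘ {φ} ψ φ-linear s = begin
    τ⊗Id (idTensor (φ ∘ ψ) (τ⊗Id s))
      ≈⟨ τ⊗Id-cong (φ₂₃-∘ φ ψ (τ⊗Id s)) ⟩
    τ⊗Id (idTensor φ (idTensor ψ (τ⊗Id s)))
      ≈⟨ τ⊗Id-cong (proj₁ (idTensor-linear φ-linear) (τ⊗Id-involutive (idTensor ψ (τ⊗Id s)))) ⟨
    τ⊗Id (idTensor φ (τ⊗Id (φ₁₃ ψ s)))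
      ∎

  φ₂₃-linearCombination : ∀ α φ β ψ
    → _≐_ EEV (φ₂₃ (E⊗V.linearCombination α φ β ψ)) (linearCombination α (φ₂₃ φ) β (φ₂₃ ψ))
  φ₂₃-linearCombination α φ β ψ 𝟎       =
    ≈sym (≈trans (⊞-cong (⊡-zeroʳ α) (⊡-zeroʳ β)) (⊞-idˡ 𝟎))
  φ₂₃-linearCombination α φ β ψ (x ⊗ w) =
    ≈trans (⊗-addʳ _ _ _) (⊞-cong (⊗-smulʳ _ _ _) (⊗-smulʳ _ _ _))
  φ₂₃-linearCombination α φ β ψ (s ⊞ t) = begin
    φ₂₃ χ s ⊞ φ₂₃ χ t
      ≈⟨ ⊞-cong (φ₂₃-linearCombination α φ β ψ s) (φ₂₃-linearCombination α φ β ψ t) ⟩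
    ((α ⊡ φ₂₃ φ s) ⊞ (β ⊡ φ₂₃ ψ s)) ⊞ ((α ⊡ φ₂₃ φ t) ⊞ (β ⊡ φ₂₃ ψ t))
      ≈⟨ ⊞-interchange _ _ _ _ ⟩
    ((α ⊡ φ₂₃ φ s) ⊞ (α ⊡ φ₂₃ φ t)) ⊞ ((β ⊡ φ₂₃ ψ s) ⊞ (β ⊡ φ₂₃ ψ t))
      ≈⟨ ⊞-cong (⊡-distˡ α _ _) (⊡-distˡ β _ _) ⟨
    (α ⊡ (φ₂₃ φ s ⊞ φ₂₃ φ t)) ⊞ (β ⊡ (φ₂₃ ψ s ⊞ φ₂₃ ψ t))
      ∎
    where χ = E⊗V.linearCombination α φ β ψ
  φ₂₃-linearCombination α φ β ψ (k ⊡ s) = begin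
    k ⊡ φ₂₃ χ s
      ≈⟨ ⊡-cong 𝕂-refl (φ₂₃-linearCombination α φ β ψ s) ⟩
    k ⊡ ((α ⊡ φ₂₃ φ s) ⊞ (β ⊡ φ₂₃ ψ s))
      ≈⟨ ⊡-distˡ k _ _ ⟩
    (k ⊡ (α ⊡ φ₂₃ φ s)) ⊞ (k ⊡ (β ⊡ φ₂₃ ψ s))
      ≈⟨ ⊞-cong (⊡-comm k α _) (⊡-comm k β _) ⟩
    (α ⊡ (k ⊡ φ₂₃ φ s)) ⊞ (β ⊡ (k ⊡ φ₂₃ ψ s))
      ∎
    where χ = E⊗V.linearCombination α φ β ψ

  φ₁₃-linearCombination : ∀ α φ β ψ
    → _≐_ EEV (φ₁₃ (E⊗V.linearCombination α φ β ψ)) (linearCombination α (φ₁₃ φ) β (φ₁₃ ψ))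
  φ₁₃-linearCombination α φ β ψ s = τ⊗Id-cong (φ₂₃-linearCombination α φ β ψ (τ⊗Id s))

  -- Apply τ ⊗ Id to the hypothesis at (τ ⊗ Id) s; the outer steps use φ₁₃ = τ φ₂₃ τ, which holds
  -- definitionally, and the involutivity of τ ⊗ Id.
  φ₂₃-commute-φ₁₃ : ∀ {φ ψ} → IsLinear EV φ → IsLinear EV ψ
                  → Commute (φ₁₃ φ) (φ₂₃ ψ) → Commute (φ₂₃ φ) (φ₁₃ ψ)
  φ₂₃-commute-φ₁₃ {φ} {ψ} φ-linear ψ-linear φ₁₃ψ₂₃ s = begin
    φ₂₃ φ (φ₁₃ ψ s)                               ≈⟨ τ⊗Id-involutive _ ⟨
    τ⊗Id (φ₁₃ φ (φ₂₃ ψ (τ⊗Id s)))                 ≈⟨ τ⊗Id-cong (φ₁₃ψ₂₃ (τ⊗Id s)) ⟩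
    τ⊗Id (φ₂₃ ψ (τ⊗Id (φ₂₃ φ (τ⊗Id (τ⊗Id s)))))   ≈⟨ inner-cong (τ⊗Id-involutive s) ⟩
    φ₁₃ ψ (φ₂₃ φ s)                               ∎
    where
    inner-cong : ∀ {s t} → s ≈ t → τ⊗Id (φ₂₃ ψ (τ⊗Id (φ₂₃ φ s))) ≈ τ⊗Id (φ₂₃ ψ (τ⊗Id (φ₂₃ φ t)))
    inner-cong p = proj₁ (φ₁₃-linear ψ-linear) (proj₁ (idTensor-linear φ-linear) p)

  module Closure {φ ψ : Space.Vec EV → Space.Vec EV}
                 (φ-linear : IsLinear EV φ) (ψ-linear : IsLinear EV ψ)
                 (φ-tree : TreeCompatible φ) (ψ-tree : TreeCompatible ψ)
                 (φ₁₃ψ₂₃ : Commute (φ₁₃ φ) (φ₂₃ ψ)) where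
    private
      ψ₁₃φ₂₃ : Commute (φ₁₃ ψ) (φ₂₃ φ)
      ψ₁₃φ₂₃ = commute-sym {φ₂₃ φ} (φ₂₃-commute-φ₁₃ φ-linear ψ-linear φ₁₃ψ₂₃)

    treeCompatible-∘ : TreeCompatible (φ ∘ ψ)
    treeCompatible-∘ =
      commute-resp-≐ (proj₁ (∘-linear (φ₁₃-linear φ-linear) (φ₁₃-linear ψ-linear)))
                     (proj₁ (∘-linear (idTensor-linear φ-linear) (idTensor-linear ψ-linear)))
                     (φ₁₃-∘ ψ φ-linear) (φ₂₃-∘ φ ψ)
                     (commute-∘ {g₂ = φ₂₃ ψ}
                                (proj₁ (φ₁₃-linear φ-linear)) (proj₁ (idTensor-linear φ-linear))
                                φ-tree φ₁₃ψ₂₃ ψ₁₃φ₂₃ ψ-tree)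

    treeCompatible-linearCombination : ∀ α β → TreeCompatible (E⊗V.linearCombination α φ β ψ)
    treeCompatible-linearCombination α β =
      commute-resp-≐ (proj₁ (linearCombination-linear α β
                              (φ₁₃-linear φ-linear) (φ₁₃-linear ψ-linear)))
                     (proj₁ φ₂₃-combination-linear)
                     (φ₁₃-linearCombination α φ β ψ) (φ₂₃-linearCombination α φ β ψ)
                     (commute-linearCombinationˡ α β φ₂₃-combination-linear
                       (commute-linearCombinationʳ {g = φ₂₃ φ} {h = φ₂₃ ψ} α β
                         (φ₁₃-linear φ-linear) φ-tree φ₁₃ψ₂₃)
                       (commute-linearCombinationʳ {g = φ₂₃ φ} {h = φ₂₃ ψ} α β
                         (φ₁₃-linear ψ-linear) ψ₁₃φ₂₃ ψ-tree))
      where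
      φ₂₃-combination-linear : IsLinear EEV (linearCombination α (φ₂₃ φ) β (φ₂₃ ψ))
      φ₂₃-combination-linear =
        linearCombination-linear α β (idTensor-linear φ-linear) (idTensor-linear ψ-linear)

proposition2p3 : {c ℓ e ℓe v ℓv : Level} (K : CommutativeRing c ℓ) → IsField K → CharacteristicZero K
  → (DE : Module K e ℓe) (DV : Module K v ℓv)
  → let open CommutativeRing K using () renaming (Carrier to 𝕂)
        open Tensor K
        open Legs (fromModule DE) (fromModule DV)
        open Space EV
    in (φ ψ : Vec → Vec) → IsLinear EV φ → IsLinear EV ψ
    → TreeCompatible φ → TreeCompatible ψ
    → _≐_ EEV (λ s → φ₁₃ φ (φ₂₃ ψ s)) (λ s → φ₂₃ ψ (φ₁₃ φ s))
    → TreeCompatible (λ s → φ (ψ s))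
      × ((α β : 𝕂) → TreeCompatible (λ s → (α ⊙ φ s) ⊕ (β ⊙ ψ s)))
proposition2p3 K _ _ DE DV φ ψ φ-linear ψ-linear φ-tree ψ-tree φ₁₃ψ₂₃ =
  treeCompatible-∘ , treeCompatible-linearCombination
  where open TreeLegs.Closure K DE DV φ-linear ψ-linear φ-tree ψ-tree φ₁₃ψ₂₃
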